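{- Let $H$ be a digraph and let $\widehat{H}$ be a strongly connected digraph containing $H$ as a subgraph. Then there exists $H^*\in GPC(H)$ such that $H^*$ is a subgraph of $\widehat{H}$.
   Context: For a digraph $H$, the class $PC(H)$ of path completions of $H$ consists of all strongly connected digraphs of the form $H^*=H\cup P_1\cup\dots\cup P_\ell$ (union of vertex sets and of arc sets), where each $P_i$ is a directed path whose two end-points lie in $V(H)$ (the paths need not be vertex-disjoint from each other or from $H$ otherwise); $\{P_1,\dots,P_\ell\}$ is called a witnessing collection of paths for $H^*$. The class $GPC(H)\subseteq PC(H)$ of good path completions consists of those $H^*\in PC(H)$ admitting such a representation in which no two paths $P_i$ have the same (ordered) pair of end-points; in particular $\ell\le|V(H)|^2$. -}

module Defs where

open import Data.Nat using (ℕ)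
open import Data.Product using (_×_; _,_; Σ; ∃; proj₁)
open import Data.Sum using (_⊎_)
open import Data.List using (List; []; _∷_; map)
open import Data.List.Relation.Unary.All using (All)
open import Data.List.Relation.Unary.Any using (Any)
open import Data.List.Relation.Unary.Unique.Propositional using (Unique)
open import Data.List.Membership.Propositional using (_∈_)
open import Function.Bundles using (_⇔_)

-- V(G) is the set of members of 'verts', A(G) the set of members of 'arcs'
-- (lists are read as finite sets; repetitions are irrelevant).
Arc : Set
Arc = ℕ × ℕ

record Digraph : Set where
  constructor mkDigraph
  field
    verts : List ℕ
    arcs  : List Arc
    arcs-ok : All (λ a → (proj₁ a ∈ verts) × (Data.Product.proj₂ a ∈ verts)) arcs
open Digraph public

_⊆G_ : Digraph → Digraph → Set
G ⊆G K = (∀ x → x ∈ verts G → x ∈ verts K) × (∀ a → a ∈ arcs G → a ∈ arcs K)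

data Walk (G : Digraph) : ℕ → ℕ → Set where
  here : ∀ {u} → Walk G u u
  step : ∀ {u v w} → (u , v) ∈ arcs G → Walk G v w → Walk G u w

StronglyConnected : Digraph → Set
StronglyConnected G = ∀ u v → u ∈ verts G → v ∈ verts G → Walk G u v

-- A directed path is given by its (nonempty) vertex sequence v₀ v₁ … vₖ,
-- represented as a pair (v₀ , [v₁ … vₖ]); its vertices must be distinct.
PathSeq : Set
PathSeq = ℕ × List ℕ

pverts : PathSeq → List ℕ
pverts (v , vs) = v ∷ vs

consecArcs : ℕ → List ℕ → List Arc
consecArcs v [] = []
consecArcs v (w ∷ ws) = (v , w) ∷ consecArcs w ws

parcs : PathSeq → List Arc
parcs (v , vs) = consecArcs v vs

lastV : ℕ → List ℕ → ℕ
lastV v [] = v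
lastV v (w ∷ ws) = lastV w ws

IsPath : PathSeq → Set
IsPath p = Unique (pverts p)

endpoints : PathSeq → ℕ × ℕ
endpoints (v , vs) = v , lastV v vs

IsUnion : Digraph → Digraph → List PathSeq → Set
IsUnion G H Ps =
  (∀ x → (x ∈ verts G) ⇔ ((x ∈ verts H) ⊎ Any (λ p → x ∈ pverts p) Ps)) ×
  (∀ a → (a ∈ arcs G) ⇔ ((a ∈ arcs H) ⊎ Any (λ p → a ∈ parcs p) Ps))

Witness : Digraph → Digraph → List PathSeq → Set
Witness H G Ps =
  All IsPath Ps ×
  All (λ p → (proj₁ (endpoints p) ∈ verts H) × (Data.Product.proj₂ (endpoints p) ∈ verts H)) Ps ×
  IsUnion G H Ps

PC : Digraph → Digraph → Set
PC H G = StronglyConnected G × ∃ λ Ps → Witness H G Ps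

GPC : Digraph → Digraph → Set
GPC H G = StronglyConnected G × ∃ λ Ps → Witness H G Ps × Unique (map endpoints Ps)

-- Take H* to be H together with one directed path of Ĥ from a to b for every
-- ordered pair (a , b) of vertices of H; such a path exists since Ĥ is strongly
-- connected, and it is obtained by cutting the cycles out of a walk. Distinct
-- pairs give distinct end-point pairs, so the collection is good. H* is strongly
-- connected: every vertex lies on one of the paths, hence is reachable from and
-- reaches a vertex of H, and any two vertices of H are joined by one of the paths.
module Submission where

open import Defs
open import Data.Nat using (ℕ)
open import Data.Nat.Properties using (_≟_)
open import Data.Product using (_×_; ∃; _,_; proj₁; proj₂)
import Data.Product as Product
open import Data.Sum using (_⊎_; inj₁; inj₂)
import Data.Sum as Sum
open import Data.List using (List; []; _∷_; map; _++_; concatMap; deduplicate; cartesianProduct)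
open import Data.List.Relation.Unary.All using (All; []; _∷_)
import Data.List.Relation.Unary.All as All
open import Data.List.Relation.Unary.All.Properties using (¬Any⇒All¬) renaming (map⁻ to All-map⁻)
open import Data.List.Relation.Unary.Any using (Any; here; there)
open import Data.List.Relation.Unary.Any.Properties using (concatMap⁺; concatMap⁻)
open import Data.List.Relation.Unary.AllPairs using ([]; _∷_)
open import Data.List.Relation.Unary.Unique.Propositional using (Unique)
open import Data.List.Relation.Unary.Unique.DecPropositional.Properties _≟_ using (deduplicate-!; cartesianProduct⁺)
open import Data.List.Relation.Binary.Subset.Propositional using (_⊆_)
open import Data.List.Membership.Propositional using (_∈_; find; lose)
open import Data.List.Membership.Propositional.Properties
  using (∈-map⁻; ∈-++⁺ˡ; ∈-++⁺ʳ; ∈-++⁻; ∈-deduplicate⁺; ∈-deduplicate⁻; ∈-cartesianProduct⁺; ∈-cartesianProduct⁻)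
open import Data.List.Membership.DecPropositional _≟_ using (_∈?_)
open import Relation.Nullary using (yes; no)
open import Relation.Binary.PropositionalEquality using (_≡_; refl; sym; trans; cong; cong₂; subst)
open import Function using (_∘_)
open import Function.Bundles using (_⇔_; mk⇔; Equivalence)

BothIn : List ℕ → ℕ × ℕ → Set
BothIn vs z = proj₁ z ∈ vs × proj₂ z ∈ vs

PathIn : Digraph → PathSeq → Set
PathIn G p = IsPath p × parcs p ⊆ arcs G

_++ʷ_ : ∀ {G u v w} → Walk G u v → Walk G v w → Walk G u w
here ++ʷ q = q
step e p ++ʷ q = step e (p ++ʷ q)

consecArcs-ends : ∀ v vs {a} → a ∈ consecArcs v vs → BothIn (v ∷ vs) a
consecArcs-ends v (w ∷ ws) (here refl) = here refl , there (here refl)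
consecArcs-ends v (w ∷ ws) (there a∈) = Product.map there there (consecArcs-ends w ws a∈)

∈-consecArcs-target : ∀ v vs {x} → x ∈ vs → ∃ λ y → (y , x) ∈ consecArcs v vs
∈-consecArcs-target v (w ∷ ws) (here refl) = v , here refl
∈-consecArcs-target v (w ∷ ws) (there x∈) = Product.map₂ there (∈-consecArcs-target w ws x∈)

module _ {G : Digraph} where

  prefixWalk : ∀ v vs {x} → consecArcs v vs ⊆ arcs G → x ∈ v ∷ vs → Walk G v x
  prefixWalk v vs       ⊆G (here refl) = here
  prefixWalk v (w ∷ ws) ⊆G (there x∈)  = step (⊆G (here refl)) (prefixWalk w ws (⊆G ∘ there) x∈)

  suffixWalk : ∀ v vs {x} → consecArcs v vs ⊆ arcs G → x ∈ v ∷ vs → Walk G x (lastV v vs)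
  suffixWalk v []       ⊆G (here refl) = here
  suffixWalk v (w ∷ ws) ⊆G (here refl) = step (⊆G (here refl)) (suffixWalk w ws (⊆G ∘ there) (here refl))
  suffixWalk v (w ∷ ws) ⊆G (there x∈)  = suffixWalk w ws (⊆G ∘ there) x∈

  pverts⊆verts : ∀ v vs → v ∈ verts G → consecArcs v vs ⊆ arcs G → v ∷ vs ⊆ verts G
  pverts⊆verts v vs v∈ ⊆G (here refl) = v∈
  pverts⊆verts v vs v∈ ⊆G (there x∈) =
    proj₂ (All.lookup (arcs-ok G) (⊆G (proj₂ (∈-consecArcs-target v vs x∈))))

path-suffix : ∀ v vs {x} → x ∈ v ∷ vs → Unique (v ∷ vs) →
  ∃ λ ws → Unique (x ∷ ws) × lastV x ws ≡ lastV v vs × consecArcs x ws ⊆ consecArcs v vs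
path-suffix v vs       (here refl) !vs      = vs , !vs , refl , λ a∈ → a∈
path-suffix v (w ∷ ws) (there x∈)  (_ ∷ !ws) =
  let us , !us , end , ⊆ws = path-suffix w ws x∈ !ws in us , !us , end , there ∘ ⊆ws

walk⇒path : ∀ {G u w} → Walk G u w → ∃ λ vs → PathIn G (u , vs) × lastV u vs ≡ w
walk⇒path here = [] , ([] ∷ [] , λ ()) , refl
walk⇒path {u = u} (step {v = v} e rest) with walk⇒path rest
... | vs , (!vs , ⊆G) , end with u ∈? v ∷ vs
...   | yes u∈ = let ws , !ws , end′ , ⊆vs = path-suffix v vs u∈ !vs in
  ws , (!ws , ⊆G ∘ ⊆vs) , trans end′ end
...   | no u∉ = v ∷ vs , (¬Any⇒All¬ _ u∉ ∷ !vs , λ { (here refl) → e ; (there a∈) → ⊆G a∈ }) , end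

pathSystem : ∀ {G} → StronglyConnected G → (zs : List (ℕ × ℕ)) → All (BothIn (verts G)) zs →
  ∃ λ Ps → All (PathIn G) Ps × map endpoints Ps ≡ zs
pathSystem sc [] [] = [] , [] , refl
pathSystem sc ((a , b) ∷ zs) ((a∈ , b∈) ∷ zs∈) with walk⇒path (sc a b a∈ b∈) | pathSystem sc zs zs∈
... | vs , path , end | Ps , paths , ends = (a , vs) ∷ Ps , path ∷ paths , cong₂ _∷_ (cong (a ,_) end) ends

allPairs : List ℕ → List (ℕ × ℕ)
allPairs vs = cartesianProduct (deduplicate _≟_ vs) (deduplicate _≟_ vs)

allPairs-unique : ∀ vs → Unique (allPairs vs)
allPairs-unique vs = cartesianProduct⁺ (deduplicate-! vs) (deduplicate-! vs)

∈-allPairs⁺ : ∀ {vs a b} → a ∈ vs → b ∈ vs → (a , b) ∈ allPairs vs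
∈-allPairs⁺ a∈ b∈ = ∈-cartesianProduct⁺ (∈-deduplicate⁺ _≟_ a∈) (∈-deduplicate⁺ _≟_ b∈)

allPairs-BothIn : ∀ vs → All (BothIn vs) (allPairs vs)
allPairs-BothIn vs = All.tabulate λ z∈ →
  Product.map (∈-deduplicate⁻ _≟_ vs) (∈-deduplicate⁻ _≟_ vs) (∈-cartesianProduct⁻ _ _ z∈)

∈-++-concatMap⇔ : ∀ {A B : Set} (f : A → List B) xs ys {x} →
  (x ∈ xs ++ concatMap f ys) ⇔ (x ∈ xs ⊎ Any (λ y → x ∈ f y) ys)
∈-++-concatMap⇔ f xs ys =
  mk⇔ (Sum.map₂ (concatMap⁻ f) ∘ ∈-++⁻ xs) Sum.[ ∈-++⁺ˡ , ∈-++⁺ʳ xs ∘ concatMap⁺ f ]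

infixl 25 _∪ᴾ_

_∪ᴾ_ : Digraph → List PathSeq → Digraph
H ∪ᴾ Ps = mkDigraph V (arcs H ++ concatMap parcs Ps) (All.tabulate arc-ends)
  where
  V : List ℕ
  V = verts H ++ concatMap pverts Ps

  inV : ∀ {x} → x ∈ verts H ⊎ Any (λ p → x ∈ pverts p) Ps → x ∈ V
  inV = Equivalence.from (∈-++-concatMap⇔ pverts (verts H) Ps)

  arc-ends : ∀ {a} → a ∈ arcs H ++ concatMap parcs Ps → BothIn V a
  arc-ends a∈ with Equivalence.to (∈-++-concatMap⇔ parcs (arcs H) Ps) a∈
  ... | inj₁ a∈H = Product.map (inV ∘ inj₁) (inV ∘ inj₁) (All.lookup (arcs-ok H) a∈H)
  ... | inj₂ a∈P with find a∈P
  ...   | (v , vs) , p∈ , a∈p =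
    Product.map (inV ∘ inj₂ ∘ lose p∈) (inV ∘ inj₂ ∘ lose p∈) (consecArcs-ends v vs a∈p)

module _ (H : Digraph) (Ps : List PathSeq) where

  ∪ᴾ-isUnion : IsUnion (H ∪ᴾ Ps) H Ps
  ∪ᴾ-isUnion = (λ x → ∈-++-concatMap⇔ pverts (verts H) Ps) , (λ a → ∈-++-concatMap⇔ parcs (arcs H) Ps)

  ∈-∪ᴾ-verts⁻ : ∀ {x} → x ∈ verts (H ∪ᴾ Ps) → x ∈ verts H ⊎ Any (λ p → x ∈ pverts p) Ps
  ∈-∪ᴾ-verts⁻ = Equivalence.to (proj₁ ∪ᴾ-isUnion _)

  parcs⊆∪ᴾ : ∀ {p} → p ∈ Ps → parcs p ⊆ arcs (H ∪ᴾ Ps)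
  parcs⊆∪ᴾ p∈ = Equivalence.from (proj₂ ∪ᴾ-isUnion _) ∘ inj₂ ∘ lose p∈

  module _ (ends-in : All (BothIn (verts H) ∘ endpoints) Ps) where

    ∪ᴾ-reachesH : ∀ {x} → x ∈ verts (H ∪ᴾ Ps) → ∃ λ b → b ∈ verts H × Walk (H ∪ᴾ Ps) x b
    ∪ᴾ-reachesH x∈ with ∈-∪ᴾ-verts⁻ x∈
    ... | inj₁ x∈H = _ , x∈H , here
    ... | inj₂ x∈P with find x∈P
    ...   | (v , vs) , p∈ , x∈p = _ , proj₂ (All.lookup ends-in p∈) , suffixWalk v vs (parcs⊆∪ᴾ p∈) x∈p

    ∪ᴾ-reachedFromH : ∀ {y} → y ∈ verts (H ∪ᴾ Ps) → ∃ λ a → a ∈ verts H × Walk (H ∪ᴾ Ps) a y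
    ∪ᴾ-reachedFromH y∈ with ∈-∪ᴾ-verts⁻ y∈
    ... | inj₁ y∈H = _ , y∈H , here
    ... | inj₂ y∈P with find y∈P
    ...   | (v , vs) , p∈ , y∈p = _ , proj₁ (All.lookup ends-in p∈) , prefixWalk v vs (parcs⊆∪ᴾ p∈) y∈p

    ∪ᴾ-stronglyConnected : (∀ {a b} → a ∈ verts H → b ∈ verts H → (a , b) ∈ map endpoints Ps) →
      StronglyConnected (H ∪ᴾ Ps)
    ∪ᴾ-stronglyConnected complete x y x∈ y∈ with ∪ᴾ-reachesH x∈ | ∪ᴾ-reachedFromH y∈
    ... | b , b∈ , x⇝b | a , a∈ , a⇝y with ∈-map⁻ endpoints (complete b∈ a∈)
    ...   | (v , vs) , p∈ , refl = x⇝b ++ʷ (suffixWalk v vs (parcs⊆∪ᴾ p∈) (here refl) ++ʷ a⇝y)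

  ∪ᴾ-⊆G : ∀ {G} → H ⊆G G → All (BothIn (verts H) ∘ endpoints) Ps → All (PathIn G) Ps → H ∪ᴾ Ps ⊆G G
  ∪ᴾ-⊆G {G} (V⊆ , A⊆) ends-in paths = verts⊆ , arcs⊆
    where
    verts⊆ : ∀ x → x ∈ verts (H ∪ᴾ Ps) → x ∈ verts G
    verts⊆ x x∈ with ∈-∪ᴾ-verts⁻ x∈
    ... | inj₁ x∈H = V⊆ x x∈H
    ... | inj₂ x∈P with find x∈P
    ...   | (v , vs) , p∈ , x∈p =
      pverts⊆verts {G} v vs (V⊆ v (proj₁ (All.lookup ends-in p∈))) (proj₂ (All.lookup paths p∈)) x∈p

    arcs⊆ : ∀ a → a ∈ arcs (H ∪ᴾ Ps) → a ∈ arcs G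
    arcs⊆ a a∈ with Equivalence.to (proj₂ ∪ᴾ-isUnion a) a∈
    ... | inj₁ a∈H = A⊆ a a∈H
    ... | inj₂ a∈P with find a∈P
    ...   | p , p∈ , a∈p = proj₂ (All.lookup paths p∈) a∈p

lemma19 : (H Ĥ : Digraph) → StronglyConnected Ĥ → H ⊆G Ĥ →
    ∃ λ (Hs : Digraph) → GPC H Hs × Hs ⊆G Ĥ
lemma19 H Ĥ Ĥ-sc H⊆Ĥ@(V⊆ , _)
  with pathSystem Ĥ-sc (allPairs (verts H)) (All.map (Product.map (V⊆ _) (V⊆ _)) (allPairs-BothIn (verts H)))
... | Ps , paths , ends≡ = H ∪ᴾ Ps , (sc , Ps , witness , unique) , ∪ᴾ-⊆G H Ps {Ĥ} H⊆Ĥ ends-in paths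
  where
  ends-in : All (BothIn (verts H) ∘ endpoints) Ps
  ends-in = All-map⁻ (subst (All (BothIn (verts H))) (sym ends≡) (allPairs-BothIn (verts H)))

  unique : Unique (map endpoints Ps)
  unique = subst Unique (sym ends≡) (allPairs-unique (verts H))

  sc : StronglyConnected (H ∪ᴾ Ps)
  sc = ∪ᴾ-stronglyConnected H Ps ends-in λ {a} {b} a∈ b∈ →
    subst ((a , b) ∈_) (sym ends≡) (∈-allPairs⁺ a∈ b∈)

  witness : Witness H (H ∪ᴾ Ps) Ps
  witness = All.map proj₁ paths , ends-in , ∪ᴾ-isUnion H Ps
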